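{- Consider an instance of the time-based container relocation problem (CRP) with first-come-first-served retrieval order, as described in the context, with $N$ containers whose departure times satisfy $d_1<d_2<\dots<d_N$, and with the objective of minimizing the total number of relocation moves. Let $R^*$ be the optimal (minimum) number of relocations when the allowed delays $\delta_n$ are arbitrarily large, and let $H \ge R^*$ be any upper bound on $R^*$. Then the allowed delays can be reduced to $$\delta^*_n = H + (n-d_n)^+, \qquad n=1,\dots,N,$$ (where $x^+=\max(x,0)$) without increasing the number of relocations; that is, the instance with $\delta_n=\delta^*_n$ for all $n$ admits a feasible sequence of moves with exactly $R^*$ relocations, so its optimal number of relocations is $R^*$.
   Context: Time-based CRP: a bay has $C$ columns and $P$ tiers; slot $[i,j]$ denotes column $i$ and tier $j$, tiers indexed from the bottom ($j=1$) to the top ($j=P$). A configuration places containers in slots so that each slot holds at most one container and there is no empty slot below an occupied slot in the same column. Initially $N$ containers $c_1,\dots,c_N$ are in the bay. Time is discretized into time steps $t=1,2,\dots,T$. At each time step at most one move is performed: either a relocation (moving a container from one slot to another slot) or a retrieval (removing a container from the bay), such that the configuration stays valid after every move; a time step with no move is idle. Container $c_n$ has a departure time $d_n$ (a positive integer: the time step at which its external truck arrives) and an allowed delay $\delta_n\ge 0$; $c_n$ must be retrieved exactly once, at some time step $t$ with $d_n \le t \le d_n+\delta_n$; the horizon is $T=\max_n(d_n+\delta_n)$. Retrievals follow the first-come-first-served order: at most $n-1$ retrievals are performed before the retrieval of $c_n$. A sequence of moves satisfying all these requirements is feasible; its number of relocations is the number of relocation moves it contains. -}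

module Defs where

open import Data.Nat using (ℕ; zero; suc; _+_; _∸_; _⊔_; _≤_; _<_; _<?_)
open import Data.Fin as Fin using (Fin; toℕ)
open import Data.List as List using (List; []; _∷_; length; concat; map; foldr; take; allFin)
open import Data.List.Relation.Binary.Permutation.Propositional using (_↭_)
open import Data.Vec as Vec using (Vec; lookup; _[_]≔_; toList)
open import Data.Maybe using (Maybe; just; nothing)
open import Data.Product using (_×_; _,_; ∃-syntax)
open import Relation.Nullary using (yes; no)
open import Relation.Binary.PropositionalEquality using (_≡_)

-- Containers c_1..c_N are represented by Fin N (c_n ↔ the Fin element with toℕ = n-1).
-- A configuration of a bay with C columns: for each column, the list of containers
-- stacked in it, HEAD = TOPMOST tier, last element = tier 1.  Representing a column as
-- a stack is exactly the "no empty slot below an occupied slot" condition; the tier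
-- limit P is imposed separately (length ≤ P).
Config : ℕ → ℕ → Set
Config N C = Vec (List (Fin N)) C

data Move (C : ℕ) : Set where
  idle  : Move C
  reloc : (from to : Fin C) → Move C
  retr  : (col : Fin C) → Move C

-- One step: fails (nothing) if the move would produce an invalid configuration
-- (moving a non-top container would leave a gap, so only top containers may move;
-- the destination must have a free tier; a relocation must change the slot).
step : ∀ {N C} → ℕ → Config N C → Move C → Maybe (Config N C × Maybe (Fin N))
step P cfg idle = just (cfg , nothing)
step P cfg (retr i) with lookup cfg i
... | [] = nothing
... | c ∷ rest = just (cfg [ i ]≔ rest , just c)
step P cfg (reloc i k) with i Fin.≟ k
... | yes _ = nothing
... | no _ with lookup cfg i
...   | [] = nothing
...   | c ∷ rest with length (lookup cfg k) <? P
...     | no _ = nothing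
...     | yes _ = just ((cfg [ i ]≔ rest) [ k ]≔ (c ∷ lookup cfg k) , nothing)

-- Run a move sequence (entry t-1 = move at time step t); on success, returns the
-- retrieval trace (entry t-1 = container retrieved at time step t, if any).
run : ∀ {N C} → ℕ → Config N C → List (Move C) → Maybe (List (Maybe (Fin N)))
run P cfg [] = just []
run P cfg (m ∷ ms) with step P cfg m
... | nothing = nothing
... | just (cfg' , r) with run P cfg' ms
...   | nothing = nothing
...   | just rs = just (r ∷ rs)

retrievals : ∀ {N} → List (Maybe (Fin N)) → ℕ
retrievals [] = 0
retrievals (nothing ∷ rs) = retrievals rs
retrievals (just _ ∷ rs) = suc (retrievals rs)

relocations : ∀ {C} → List (Move C) → ℕ
relocations [] = 0
relocations (idle ∷ ms) = relocations ms
relocations (reloc _ _ ∷ ms) = suc (relocations ms)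
relocations (retr _ ∷ ms) = relocations ms

ValidInitial : ∀ {N C} → ℕ → Config N C → Set
ValidInitial {N} P init =
  (∀ i → length (lookup init i) ≤ P) × (concat (toList init) ↭ allFin N)

horizon : ∀ {N} → (Fin N → ℕ) → (Fin N → ℕ) → ℕ
horizon {N} d δ = foldr _⊔_ 0 (map (λ n → d n + δ n) (allFin N))

-- Feasible sequence of moves for the instance (P, init, d, δ): one move per time step
-- t = 1..T, every move keeps the configuration valid, each container c_n is retrieved
-- exactly once at a time step t with d_n ≤ t ≤ d_n + δ_n, and at most n-1 retrievals
-- happen before that of c_n (FCFS).
Feasible : ∀ {N C} → ℕ → Config N C → (Fin N → ℕ) → (Fin N → ℕ) → List (Move C) → Set
Feasible {N} P init d δ ms =
  length ms ≡ horizon d δ ×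
  ∃[ tr ] (run P init ms ≡ just tr ×
    (∀ (n : Fin N) → ∃[ t ] (List.lookup tr t ≡ just n ×
        (∀ t' → List.lookup tr t' ≡ just n → t' ≡ t) ×
        d n ≤ suc (toℕ t) ×
        suc (toℕ t) ≤ d n + δ n ×
        retrievals (take (toℕ t) tr) ≤ toℕ n)))

-- R is the optimal number of relocations when the allowed delays are arbitrarily large:
-- since enlarging the delays only enlarges the set of feasible sequences, this is the
-- minimum of the relocation count over feasible sequences for all delay vectors δ.
IsOptimalUnboundedDelay : ∀ {N C} → ℕ → Config N C → (Fin N → ℕ) → ℕ → Set
IsOptimalUnboundedDelay {N} {C} P init d R =
  (∃[ δ ] ∃[ ms ] (Feasible P init d δ ms × relocations {C} ms ≡ R)) ×
  (∀ (δ : Fin N → ℕ) (ms : List (Move C)) → Feasible P init d δ ms → R ≤ relocations ms)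

reducedDelay : ∀ {N} → ℕ → (Fin N → ℕ) → Fin N → ℕ
reducedDelay H d i = H + (suc (toℕ i) ∸ d i)

-- An optimal schedule for unbounded delays still works after removing all idle steps
-- and then, before each retrieval of c_n, idling just until the truck time d_n.  This
-- keeps every move, so the relocation count and the sequence of configurations are
-- unchanged, and the retrievals still occur in FCFS order 1, …, N.  Because d is
-- increasing, an induction over the moves shows that c_n is then retrieved no later than
-- r + max(n, d_n), where r ≤ R* ≤ H is the number of relocations performed before it;
-- this is exactly the deadline d_n + δ*_n = H + max(n, d_n).
module Submission where

open import Defs
open import Data.Nat using (ℕ; _≤_; _<_)
open import Data.Fin using (Fin)
open import Data.List using (List)
open import Data.Product using (_×_; ∃-syntax)
open import Relation.Binary.PropositionalEquality using (_≡_)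

open import Data.Nat using (zero; suc; _+_; _∸_; _⊔_; z≤n; s≤s; _<?_)
open import Data.Nat.Properties
open import Data.Fin using (toℕ; fromℕ<) renaming (zero to fzero; suc to fsuc)
import Data.Fin as Fin
open import Data.Fin.Properties using (toℕ-injective; toℕ-fromℕ<; toℕ<n) renaming (suc-injective to fsuc-injective)
open import Data.List using ([]; _∷_; length; replicate; _++_; take; drop; foldr; lookup)
open import Data.List.Properties using (++-identityʳ)
open import Data.List.Relation.Unary.Any using (here; there)
open import Data.List.Membership.Propositional using (_∈_)
open import Data.List.Membership.Propositional.Properties using (∈-map⁺; ∈-allFin)
import Data.Vec as Vec
open import Data.Maybe using (Maybe; just; nothing)
open import Data.Maybe.Properties using (just-injective)
open import Data.Product using (_,_)
open import Data.Sum using (inj₁; inj₂)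
open import Data.Unit using (⊤; tt)
open import Data.Empty using (⊥; ⊥-elim)
open import Relation.Nullary using (yes; no; ¬_)
open import Relation.Binary.PropositionalEquality using (refl; sym; trans; cong; subst; module ≡-Reasoning)

m∸n+n≡m⊔n : ∀ m n → m ∸ n + n ≡ m ⊔ n
m∸n+n≡m⊔n m n with ≤-total n m
... | inj₁ n≤m = trans (m∸n+n≡m n≤m) (sym (m≥n⇒m⊔n≡m n≤m))
... | inj₂ m≤n rewrite m≤n⇒m∸n≡0 m≤n = sym (m≤n⇒m⊔n≡n m≤n)

∈⇒≤-foldr-⊔ : ∀ {x xs} → x ∈ xs → x ≤ foldr _⊔_ 0 xs
∈⇒≤-foldr-⊔ {xs = x ∷ xs} (here refl) = m≤m⊔n x _
∈⇒≤-foldr-⊔ {xs = x ∷ xs} (there x∈xs) = ≤-trans (∈⇒≤-foldr-⊔ x∈xs) (m≤n⊔m x _)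

retrievalTime-bound : ∀ {D e p r b} → D ≤ e → p ≤ r + b → b < e → D ⊔ suc p ≤ r + e
retrievalTime-bound {e = e} {p} {r} {b} D≤e p≤r+b b<e = ⊔-lub (≤-trans D≤e (m≤n+m e r)) (begin
  suc p       ≤⟨ s≤s p≤r+b ⟩
  suc (r + b) ≡⟨ sym (+-suc r b) ⟩
  r + suc b   ≤⟨ +-monoʳ-≤ r b<e ⟩
  r + e       ∎)
  where open ≤-Reasoning

Trace : ℕ → Set
Trace N = List (Maybe (Fin N))

module _ {N : ℕ} where

  RetrievedOnceAt : (tr : Trace N) → Fin N → Fin (length tr) → Set
  RetrievedOnceAt tr n t = lookup tr t ≡ just n × (∀ t' → lookup tr t' ≡ just n → t' ≡ t)

  retrievedOnceAt-∷⁻ : ∀ {r tr n t} → RetrievedOnceAt (r ∷ tr) n (fsuc t) → RetrievedOnceAt tr n t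
  retrievedOnceAt-∷⁻ (at , once) = at , λ t' e → fsuc-injective (once (fsuc t') e)

  RetrievesFrom : ℕ → Trace N → Set
  RetrievesFrom k [] = k ≡ N
  RetrievesFrom k (nothing ∷ tr) = RetrievesFrom k tr
  RetrievesFrom k (just x ∷ tr) = toℕ x ≡ k × RetrievesFrom (suc k) tr

  FcfsRetrieved : ℕ → (tr : Trace N) → Fin N → Set
  FcfsRetrieved k tr n = ∃[ t ] (RetrievedOnceAt tr n t × k + retrievals (take (toℕ t) tr) ≤ toℕ n)

  -- The FCFS part of feasibility, relativised to the containers c_{k+1}, …, c_N.
  FcfsFrom : ℕ → Trace N → Set
  FcfsFrom k tr =
    k ≤ N × (∀ n → k ≤ toℕ n → FcfsRetrieved k tr n) × (∀ n t → lookup tr t ≡ just n → k ≤ toℕ n)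

  fcfsFrom-nothing⁻ : ∀ {k tr} → FcfsFrom k (nothing ∷ tr) → FcfsFrom k tr
  fcfsFrom-nothing⁻ {k} {tr} (k≤N , once , above) = k≤N , once′ , λ n t → above n (fsuc t)
    where
    once′ : ∀ n → k ≤ toℕ n → FcfsRetrieved k tr n
    once′ n k≤n with once n k≤n
    ... | fzero , () , _
    ... | fsuc t , retrieved , before = t , retrievedOnceAt-∷⁻ retrieved , before

  -- c_{k+1} is retrieved before any other retrieval, so it is the first one in the trace.
  fcfsFrom-just⁻ : ∀ {k x tr} → FcfsFrom k (just x ∷ tr) → toℕ x ≡ k × FcfsFrom (suc k) tr
  fcfsFrom-just⁻ {k} {x} {tr} (k≤N , once , above) = x≡k , k<N , once′ , above′
    where
    k<N : k < N
    k<N = ≤-<-trans (above x fzero refl) (toℕ<n x)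
    x≡k : toℕ x ≡ k
    x≡k with once (fromℕ< k<N) (≤-reflexive (sym (toℕ-fromℕ< k<N)))
    ... | fzero , (at , _) , _ = trans (cong toℕ (just-injective at)) (toℕ-fromℕ< k<N)
    ... | fsuc t , _ , before = ⊥-elim (<-irrefl refl (begin-strict
          k                                      <⟨ m<m+n k (s≤s z≤n) ⟩
          k + suc (retrievals (take (toℕ t) tr)) ≤⟨ before ⟩
          toℕ (fromℕ< k<N)                       ≡⟨ toℕ-fromℕ< k<N ⟩
          k                                      ∎))
      where open ≤-Reasoning
    once′ : ∀ n → suc k ≤ toℕ n → FcfsRetrieved (suc k) tr n
    once′ n k<n with once n (<⇒≤ k<n)
    ... | fzero , (at , _) , _ = ⊥-elim (<-irrefl (trans (sym x≡k) (cong toℕ (just-injective at))) k<n)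
    ... | fsuc t , retrieved , before = t , retrievedOnceAt-∷⁻ retrieved , subst (_≤ toℕ n) (+-suc k _) before
    above′ : ∀ n t → lookup tr t ≡ just n → suc k ≤ toℕ n
    above′ n t at = ≤∧≢⇒< (above n (fsuc t) at) λ k≡n → x-later (toℕ-injective (trans x≡k k≡n))
      where
      x-later : x ≡ n → ⊥
      x-later refl with once x (above x fzero refl)
      ... | _ , (_ , only) , _ with trans (only (fsuc t) at) (sym (only fzero refl))
      ... | ()

  fcfsFrom⇒retrievesFrom : ∀ k tr → FcfsFrom k tr → RetrievesFrom k tr
  fcfsFrom⇒retrievesFrom k [] (k≤N , once , _) with m≤n⇒m<n∨m≡n k≤N
  ... | inj₂ k≡N = k≡N
  ... | inj₁ k<N with once (fromℕ< k<N) (≤-reflexive (sym (toℕ-fromℕ< k<N)))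
  ...   | () , _
  fcfsFrom⇒retrievesFrom k (nothing ∷ tr) fcfs = fcfsFrom⇒retrievesFrom k tr (fcfsFrom-nothing⁻ fcfs)
  fcfsFrom⇒retrievesFrom k (just x ∷ tr) fcfs with fcfsFrom-just⁻ fcfs
  ... | x≡k , fcfs′ = x≡k , fcfsFrom⇒retrievesFrom (suc k) tr fcfs′

  retrievesFrom⇒notRetrieved : ∀ {k tr n} → RetrievesFrom k tr → toℕ n < k → ∀ t → ¬ lookup tr t ≡ just n
  retrievesFrom⇒notRetrieved {tr = nothing ∷ tr} order n<k (fsuc t) = retrievesFrom⇒notRetrieved {tr = tr} order n<k t
  retrievesFrom⇒notRetrieved {tr = just x ∷ tr} (x≡k , order) n<k fzero refl = <-irrefl x≡k n<k
  retrievesFrom⇒notRetrieved {tr = just x ∷ tr} (_ , order) n<k (fsuc t) =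
    retrievesFrom⇒notRetrieved {tr = tr} order (m≤n⇒m≤1+n n<k) t

  InWindow : (d δ : Fin N → ℕ) → Fin N → ℕ → Set
  InWindow d δ n t = d n ≤ t × t ≤ d n + δ n

  -- the first entry of the trace is time step p + 1
  InWindows : (d δ : Fin N → ℕ) → ℕ → Trace N → Set
  InWindows d δ p [] = ⊤
  InWindows d δ p (nothing ∷ tr) = InWindows d δ (suc p) tr
  InWindows d δ p (just x ∷ tr) = InWindow d δ x (suc p) × InWindows d δ (suc p) tr

  retrievesFrom⇒retrievedInWindow : ∀ (d δ : Fin N → ℕ) {k p tr} → RetrievesFrom k tr → InWindows d δ p tr →
    ∀ n → k ≤ toℕ n →
    ∃[ t ] (RetrievedOnceAt tr n t × InWindow d δ n (p + suc (toℕ t)) ×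
            k + retrievals (take (toℕ t) tr) ≡ toℕ n)
  retrievesFrom⇒retrievedInWindow d δ {tr = []} k≡N _ n k≤n =
    ⊥-elim (<-irrefl k≡N (≤-<-trans k≤n (toℕ<n n)))
  retrievesFrom⇒retrievedInWindow d δ {k} {p} {nothing ∷ tr} order windows n k≤n
    with retrievesFrom⇒retrievedInWindow d δ order windows n k≤n
  ... | t , (at , only) , window , count =
    fsuc t , (at , once) , subst (InWindow d δ n) (sym (+-suc p _)) window , count
    where
    once : ∀ t' → lookup (nothing ∷ tr) t' ≡ just n → t' ≡ fsuc t
    once (fsuc t') e = cong fsuc (only t' e)
  retrievesFrom⇒retrievedInWindow d δ {k} {p} {just x ∷ tr} (x≡k , order) (xwindow , windows) n k≤n
    with toℕ n ≟ k
  ... | yes n≡k rewrite toℕ-injective {i = x} (trans x≡k (sym n≡k)) =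
    fzero , (refl , once) , subst (InWindow d δ n) (sym (+-comm p 1)) xwindow , trans (+-identityʳ k) (sym n≡k)
    where
    once : ∀ t' → lookup (just n ∷ tr) t' ≡ just n → t' ≡ fzero
    once fzero _ = refl
    once (fsuc t') e = ⊥-elim (retrievesFrom⇒notRetrieved {tr = tr} order (s≤s (≤-reflexive n≡k)) t' e)
  ... | no n≢k
    with retrievesFrom⇒retrievedInWindow d δ order windows n (≤∧≢⇒< k≤n (λ k≡n → n≢k (sym k≡n)))
  ...   | t , (at , only) , window , count =
    fsuc t , (at , once) , subst (InWindow d δ n) (sym (+-suc p _)) window , trans (+-suc k _) count
    where
    once : ∀ t' → lookup (just x ∷ tr) t' ≡ just n → t' ≡ fsuc t
    once fzero refl = ⊥-elim (n≢k x≡k)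
    once (fsuc t') e = cong fsuc (only t' e)

module _ {N C : ℕ} (P : ℕ) where

  step-reloc-retrievesNothing : ∀ {cfg : Config N C} {i j cfg' r} →
    step P cfg (reloc i j) ≡ just (cfg' , r) → r ≡ nothing
  step-reloc-retrievesNothing {cfg} {i} {j} e with i Fin.≟ j
  step-reloc-retrievesNothing () | yes _
  ... | no _ with Vec.lookup cfg i
  step-reloc-retrievesNothing () | no _ | []
  ... | c ∷ rest with length (Vec.lookup cfg j) <? P
  step-reloc-retrievesNothing () | no _ | c ∷ rest | no _
  step-reloc-retrievesNothing refl | no _ | c ∷ rest | yes _ = refl

  step-retr-retrieves : ∀ {cfg : Config N C} {i cfg' r} →
    step P cfg (retr i) ≡ just (cfg' , r) → ∃[ x ] (r ≡ just x)
  step-retr-retrieves {cfg} {i} e with Vec.lookup cfg i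
  step-retr-retrieves () | []
  step-retr-retrieves refl | c ∷ rest = c , refl

  run-∷⁻ : ∀ {cfg : Config N C} {m ms tr} → run P cfg (m ∷ ms) ≡ just tr →
    ∃[ cfg' ] ∃[ r ] ∃[ rs ] (step P cfg m ≡ just (cfg' , r) × run P cfg' ms ≡ just rs × tr ≡ r ∷ rs)
  run-∷⁻ {cfg} {m} {ms} e with step P cfg m in stepped
  run-∷⁻ () | nothing
  ... | just (cfg' , r) with run P cfg' ms in ran
  run-∷⁻ () | just (cfg' , r) | nothing
  run-∷⁻ refl | just (cfg' , r) | just rs = cfg' , r , rs , refl , ran , refl

  run-∷ : ∀ {cfg cfg' : Config N C} {m ms r rs} → step P cfg m ≡ just (cfg' , r) →
    run P cfg' ms ≡ just rs → run P cfg (m ∷ ms) ≡ just (r ∷ rs)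
  run-∷ stepped ran rewrite stepped | ran = refl

relocations-idles : ∀ {C} w (ms : List (Move C)) → relocations (replicate w idle ++ ms) ≡ relocations ms
relocations-idles zero ms = refl
relocations-idles (suc w) ms = relocations-idles w ms

-- The rescheduled sequence, started at time p (the number of moves already performed)
-- and padded with idle steps up to time T.  It follows the trace of the original run to
-- know which container each retrieval removes; the last clause is never reached by a
-- sequence that runs successfully.
module _ {N C : ℕ} (d : Fin N → ℕ) (T : ℕ) where

  reschedule : ℕ → List (Move C) → Trace N → List (Move C)
  reschedule p [] _ = replicate (T ∸ p) idle
  reschedule p (idle ∷ ms) tr = reschedule p ms (drop 1 tr)
  reschedule p (reloc i j ∷ ms) tr = reloc i j ∷ reschedule (suc p) ms (drop 1 tr)
  reschedule p (retr i ∷ ms) (just x ∷ tr) =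
    replicate (d x ∸ suc p) idle ++ retr i ∷ reschedule (d x ⊔ suc p) ms tr
  reschedule p (retr i ∷ ms) tr = retr i ∷ reschedule (suc p) ms (drop 1 tr)

  relocations-reschedule : ∀ p ms tr → relocations (reschedule p ms tr) ≡ relocations ms
  relocations-reschedule p [] _ =
    subst (λ ms → relocations ms ≡ 0) (++-identityʳ (replicate (T ∸ p) idle)) (relocations-idles (T ∸ p) [])
  relocations-reschedule p (idle ∷ ms) tr = relocations-reschedule p ms (drop 1 tr)
  relocations-reschedule p (reloc i j ∷ ms) tr = cong suc (relocations-reschedule (suc p) ms (drop 1 tr))
  relocations-reschedule p (retr i ∷ ms) (just x ∷ tr) =
    trans (relocations-idles (d x ∸ suc p) _) (relocations-reschedule (d x ⊔ suc p) ms tr)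
  relocations-reschedule p (retr i ∷ ms) [] = relocations-reschedule (suc p) ms []
  relocations-reschedule p (retr i ∷ ms) (nothing ∷ tr) = relocations-reschedule (suc p) ms tr

module _ {N C : ℕ} (P : ℕ) (d δ : Fin N → ℕ) (T : ℕ) where

  Completes : Config N C → ℕ → ℕ → List (Move C) → Set
  Completes cfg k p ms =
    p + length ms ≡ T × ∃[ tr ] (run P cfg ms ≡ just tr × RetrievesFrom k tr × InWindows d δ p tr)

  completes-∷-nothing : ∀ {cfg cfg' k p m ms} → step P cfg m ≡ just (cfg' , nothing) →
    Completes cfg' k (suc p) ms → Completes cfg k p (m ∷ ms)
  completes-∷-nothing {cfg} {cfg'} {p = p} {m} {ms} stepped (len , tr , ran , order , windows) =
    trans (+-suc p _) len , nothing ∷ tr , run-∷ P {cfg} {cfg'} {m} {ms} stepped ran , order , windows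

  completes-∷-just : ∀ {cfg cfg' k p m ms x} → step P cfg m ≡ just (cfg' , just x) → toℕ x ≡ k →
    InWindow d δ x (suc p) → Completes cfg' (suc k) (suc p) ms → Completes cfg k p (m ∷ ms)
  completes-∷-just {cfg} {cfg'} {p = p} {m} {ms} stepped x≡k window (len , tr , ran , order , windows) =
    trans (+-suc p _) len , just _ ∷ tr , run-∷ P {cfg} {cfg'} {m} {ms} stepped ran ,
    (x≡k , order) , (window , windows)

  completes-idles : ∀ {cfg k p ms} w → Completes cfg k (w + p) ms → Completes cfg k p (replicate w idle ++ ms)
  completes-idles zero completes = completes
  completes-idles {cfg} {k} {p} {ms} (suc w) completes =
    completes-∷-nothing {cfg} {cfg} {k} {p} {idle} {replicate w idle ++ ms} refl
      (completes-idles w (subst (λ q → Completes cfg k q ms) (sym (+-suc w p)) completes))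

  completes-idleUntil-horizon : ∀ {cfg p} → p ≤ T → Completes cfg N p (replicate (T ∸ p) idle)
  completes-idleUntil-horizon {cfg} {p} p≤rr+dueT =
    subst (Completes cfg N p) (++-identityʳ (replicate (T ∸ p) idle))
      (completes-idles (T ∸ p) (subst (λ q → Completes cfg N q []) (sym (m∸n+n≡m p≤rr+dueT)) done))
    where
    done : Completes cfg N T []
    done = +-identityʳ T , [] , refl , refl , tt

  completes-wait-retrieve : ∀ {cfg cfg' k p m ms x} → step P cfg m ≡ just (cfg' , just x) → toℕ x ≡ k →
    InWindow d δ x (d x ⊔ suc p) → Completes cfg' (suc k) (d x ⊔ suc p) ms →
    Completes cfg k p (replicate (d x ∸ suc p) idle ++ m ∷ ms)
  completes-wait-retrieve {cfg} {cfg'} {k} {p} {m} {ms} {x} stepped x≡k window completes =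
    completes-idles (d x ∸ suc p)
      (completes-∷-just {cfg} {cfg'} {k} {d x ∸ suc p + p} {m} {ms} stepped x≡k
        (subst (InWindow d δ x) (sym retrievalTime) window)
        (subst (λ q → Completes cfg' (suc k) q ms) (sym retrievalTime) completes))
    where
    retrievalTime : suc (d x ∸ suc p + p) ≡ d x ⊔ suc p
    retrievalTime = trans (sym (+-suc _ p)) (m∸n+n≡m⊔n (d x) (suc p))

module _ {N : ℕ} where

  -- the most recently retrieved container, when c_1, …, c_k have been retrieved
  Previous : ℕ → Maybe (Fin N) → Set
  Previous k nothing = k ≡ 0
  Previous k (just y) = suc (toℕ y) ≡ k

  due : (Fin N → ℕ) → Fin N → ℕ
  due d y = suc (toℕ y) ⊔ d y

  dueOf : (Fin N → ℕ) → Maybe (Fin N) → ℕ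
  dueOf d nothing = 0
  dueOf d (just y) = due d y

  dueOf-previous< : ∀ {d k last x} → (∀ m n → m Fin.< n → d m < d n) →
    Previous k last → toℕ x ≡ k → dueOf d last < due d x
  dueOf-previous< {d} {k} {nothing} {x} _ _ _ = ≤-trans (s≤s z≤n) (m≤m⊔n (suc (toℕ x)) (d x))
  dueOf-previous< {d} {k} {just y} {x} d-increasing y+1≡k x≡k =
    ⊔-mono-< (s≤s y<x) (d-increasing y x y<x)
    where
    y<x : suc (toℕ y) ≤ toℕ x
    y<x = ≤-reflexive (trans y+1≡k (sym x≡k))

  reducedDeadline : ∀ (d : Fin N → ℕ) H n → d n + reducedDelay H d n ≡ H + due d n
  reducedDeadline d H n = begin
    d n + (H + (suc (toℕ n) ∸ d n)) ≡⟨ +-comm (d n) _ ⟩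
    (H + (suc (toℕ n) ∸ d n)) + d n ≡⟨ +-assoc H _ (d n) ⟩
    H + (suc (toℕ n) ∸ d n + d n)   ≡⟨ cong (H +_) (m∸n+n≡m⊔n (suc (toℕ n)) (d n)) ⟩
    H + due d n                     ∎
    where open ≡-Reasoning

  due≤horizon : ∀ (d : Fin N → ℕ) H n → H + due d n ≤ horizon d (reducedDelay H d)
  due≤horizon d H n = subst (_≤ horizon d (reducedDelay H d)) (reducedDeadline d H n)
    (∈⇒≤-foldr-⊔ (∈-map⁺ (λ m → d m + reducedDelay H d m) (∈-allFin n)))

module _ {N C : ℕ} (P : ℕ) (d : Fin N → ℕ) (d-increasing : ∀ m n → m Fin.< n → d m < d n)
         (H R : ℕ) (R≤H : R ≤ H)
         (finishesInTime : ∀ last → Previous N last → R + dueOf d last ≤ horizon d (reducedDelay H d)) where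

  private
    δ* : Fin N → ℕ
    δ* = reducedDelay H d
    T : ℕ
    T = horizon d δ*

  reschedule-completes : ∀ ms tr (cfg : Config N C) p k last rr → run P cfg ms ≡ just tr →
    RetrievesFrom k tr → Previous k last → p ≤ rr + dueOf d last → rr + relocations ms ≡ R →
    Completes P d δ* T cfg k p (reschedule d T p ms tr)
  reschedule-completes [] .[] cfg p k last rr refl refl previous p≤rr+due rr+0≡R =
    completes-idleUntil-horizon P d δ* T
      (≤-trans p≤rr+due (subst (λ r → r + dueOf d last ≤ T) (sym rr≡R) (finishesInTime last previous)))
    where
    rr≡R : rr ≡ R
    rr≡R = trans (sym (+-identityʳ rr)) rr+0≡R
  reschedule-completes (m ∷ ms) tr cfg p k last rr ran order previous p≤rr+due rr≡R
    with run-∷⁻ P {cfg} {m} {ms} ran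
  reschedule-completes (idle ∷ ms) .(nothing ∷ rs) cfg p k last rr _ order previous p≤rr+due rr≡R
    | .cfg , .nothing , rs , refl , ran , refl =
    reschedule-completes ms rs cfg p k last rr ran order previous p≤rr+due rr≡R
  reschedule-completes (reloc i j ∷ ms) .(r ∷ rs) cfg p k last rr _ order previous p≤rr+due rr≡R
    | cfg' , r , rs , stepped , ran , refl with step-reloc-retrievesNothing P {cfg} {i} {j} stepped
  ... | refl = completes-∷-nothing P d δ* T {cfg} {cfg'} {k} {p} {reloc i j} stepped
    (reschedule-completes ms rs cfg' (suc p) k last (suc rr) ran order previous
      (s≤s p≤rr+due) (trans (sym (+-suc rr _)) rr≡R))
  reschedule-completes (retr i ∷ ms) .(r ∷ rs) cfg p k last rr _ order′ previous p≤rr+due rr≡R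
    | cfg' , r , rs , stepped , ran , refl with step-retr-retrieves P {cfg} {i} stepped | order′
  ... | x , refl | x≡k , order =
    completes-wait-retrieve P d δ* T {cfg} {cfg'} {k} {p} {retr i} stepped x≡k
      (m≤m⊔n (d x) (suc p) , ≤-trans time≤H+due (≤-reflexive (sym (reducedDeadline d H x))))
      (reschedule-completes ms rs cfg' (d x ⊔ suc p) (suc k) (just x) rr ran order (cong suc x≡k)
        time≤rr+due rr≡R)
    where
    time≤rr+due : d x ⊔ suc p ≤ rr + due d x
    time≤rr+due = retrievalTime-bound (m≤n⊔m _ (d x)) p≤rr+due (dueOf-previous< d-increasing previous x≡k)
    time≤H+due : d x ⊔ suc p ≤ H + due d x
    time≤H+due = ≤-trans time≤rr+due (+-monoˡ-≤ (due d x) (≤-trans (m≤m+n rr _) (≤-trans (≤-reflexive rr≡R) R≤H)))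

completes⇒feasible : ∀ {N C} P (init : Config N C) (d δ : Fin N → ℕ) ms →
  Completes P d δ (horizon d δ) init 0 0 ms → Feasible P init d δ ms
completes⇒feasible P init d δ ms (len , tr , ran , order , windows) = len , tr , ran , λ n →
  let t , (at , once) , (after , before) , count = retrievesFrom⇒retrievedInWindow d δ {0} {0} {tr} order windows n z≤n
  in  t , at , once , after , before , ≤-reflexive count

-- With no containers the horizon is 0, so the optimal sequence is empty and R = 0.
optimal-finishesInTime : ∀ {N C} (d δ : Fin N → ℕ) {R} H (ms : List (Move C)) → R ≤ H →
  length ms ≡ horizon d δ → relocations ms ≡ R →
  ∀ last → Previous N last → R + dueOf d last ≤ horizon d (reducedDelay H d)
optimal-finishesInTime d δ H [] R≤H len refl nothing refl = z≤n
optimal-finishesInTime d δ H (_ ∷ _) R≤H () relocs nothing refl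
optimal-finishesInTime d δ H ms R≤H len relocs (just y) _ = ≤-trans (+-monoˡ-≤ (due d y) R≤H) (due≤horizon d H y)

proposition1 : (C P N : ℕ) (init : Config N C) → ValidInitial P init →
    (d : Fin N → ℕ) → (∀ n → 1 ≤ d n) → (∀ m n → m Data.Fin.< n → d m < d n) →
    (R H : ℕ) → IsOptimalUnboundedDelay P init d R → R ≤ H →
    (∃[ ms ] (Feasible P init d (reducedDelay H d) ms × relocations {C} ms ≡ R)) ×
    (∀ (ms : List (Move C)) → Feasible P init d (reducedDelay H d) ms → R ≤ relocations ms)
proposition1 C P N init _ d _ d-increasing R H ((δ , ms , (len , tr , ran , retrieved) , relocs) , optimal) R≤H =
  (ms* , completes⇒feasible P init d δ* ms* completes , trans (relocations-reschedule d T 0 ms tr) relocs) ,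
  optimal δ*
  where
  δ* : Fin N → ℕ
  δ* = reducedDelay H d
  T : ℕ
  T = horizon d δ*
  ms* : List (Move C)
  ms* = reschedule d T 0 ms tr
  order : RetrievesFrom 0 tr
  order = fcfsFrom⇒retrievesFrom 0 tr (z≤n , fcfs , λ _ _ _ → z≤n)
    where
    fcfs : ∀ n → 0 ≤ toℕ n → FcfsRetrieved 0 tr n
    fcfs n _ = let t , at , once , _ , _ , before = retrieved n in t , (at , once) , before
  completes : Completes P d δ* T init 0 0 ms*
  completes = reschedule-completes P d d-increasing H R R≤H (optimal-finishesInTime d δ H ms R≤H len relocs)
    ms tr init 0 0 nothing 0 ran order refl z≤n relocs
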